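{- Let $(s_n)_{n\ge1}$ be the Look-Knave sequence, defined below. For every $n\ge1$, every maximal run of consecutive $0$s in $s_n$ has length at most $3$.
   Context: For a positive integer $m$, let $[m]$ denote the binary representation of $m$, with no leading zeros. For a finite binary string $s$, write $s=r_1r_2\cdots r_t$ as a concatenation of maximal runs: each $r_i$ is a nonempty block of a single repeated bit $b_i$, and consecutive runs use different bits. Define $$k(s)=[|r_1|]\,\overline{b_1}\,[|r_2|]\,\overline{b_2}\cdots[|r_t|]\,\overline{b_t},$$ where $\overline{b}$ denotes the complement of the bit $b$. The Look-Knave sequence is given by $s_1=1$ and $s_n=k(s_{n-1})$ for $n\ge2$. -}

module Defs where

open import Data.Nat using (ℕ; zero; suc; _+_; _*_; _≤_)
open import Data.Nat.DivMod using (_/_; _%_)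
open import Data.Bool using (Bool; true; false; not; _∧_)
open import Data.List using (List; []; _∷_; _++_; [_])
open import Data.Product using (_×_; _,_)

-- Bits: true = 1, false = 0.

-- Binary digits of m (most significant first), computed with fuel;
-- with fuel ≥ m this is the usual representation for m ≥ 1 (no leading zeros).
binAux : ℕ → ℕ → List Bool
binAux zero    m = []
binAux (suc f) zero = []
binAux (suc f) m@(suc _) = binAux f (m / 2) ++ [ isOne (m % 2) ]
  where
  isOne : ℕ → Bool
  isOne zero = false
  isOne (suc _) = true

bin : ℕ → List Bool
bin m = binAux m m

eqB : Bool → Bool → Bool
eqB true true = true
eqB false false = true
eqB _ _ = false

runs : List Bool → List (ℕ × Bool)
runs [] = []
runs (b ∷ s) with runs s
... | [] = (1 , b) ∷ []
... | (l , c) ∷ rs with eqB b c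
...   | true  = (suc l , c) ∷ rs
...   | false = (1 , b) ∷ (l , c) ∷ rs

encodeRuns : List (ℕ × Bool) → List Bool
encodeRuns [] = []
encodeRuns ((l , b) ∷ rs) = bin l ++ not b ∷ encodeRuns rs

k : List Bool → List Bool
k s = encodeRuns (runs s)

-- Look-Knave sequence (0-indexed): s n = s_(n+1), i.e. s_1 = 1, s_n = k(s_(n-1)).
s : ℕ → List Bool
s zero = true ∷ []
s (suc n) = k (s n)

-- s_n for n ≥ 1 (paper indexing); sₙ 0 is given the junk value s_1.
sₙ : ℕ → List Bool
sₙ zero = s zero
sₙ (suc n) = s n

module Submission where

-- Call a run list b-bounded if its runs alternate, the
-- first run consists of the bit b, and every run of 1s has length at
-- most 5 and every run of 0s length at most 3.  We show that the run
-- list of every term s n is 1-bounded; the corollary is then read off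
-- from the bound on runs of 0s.
--
-- The induction step computes the runs of k(s) = encodeRuns (runs s)
-- from right to left: by  runs-++  the runs of a block  [l] ~b  placed
-- in front of an already encoded suffix are obtained by pushing the
-- bits of the block one at a time onto the runs of the suffix.  Since
-- l ≤ 5 (resp. l ≤ 3), only finitely many blocks occur and each is
-- checked by computation.  A block for a run of 0s ends in 1 and may
-- merge with the leading 1s of the suffix; this is controlled by the
-- extra fact that the encoding of a run list starting with a run of 1s
-- itself starts with at most two 1s.

open import Defs
open import Data.Nat using (ℕ; zero; suc; _≤_; _≤ᵇ_; s≤s)
open import Data.Nat.Properties using (≤ᵇ⇒≤; ≤-trans)
open import Data.Bool using (Bool; true; false; not; T)
open import Data.Product using (_×_; _,_; proj₁)
open import Data.List using (List; []; _∷_; _++_; foldr)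
open import Data.Unit using (⊤)
open import Data.List.Membership.Propositional using (_∈_)
open import Data.List.Relation.Unary.Any using (here; there)
open import Relation.Binary.PropositionalEquality using (_≡_; refl; cong; trans; subst; sym)

RunList : Set
RunList = List (ℕ × Bool)

≤-lit : ∀ {m n} {_ : T (m ≤ᵇ n)} → m ≤ n
≤-lit {m} {n} {m≤ᵇn} = ≤ᵇ⇒≤ m n m≤ᵇn

pushBit : Bool → RunList → RunList
pushBit b [] = (1 , b) ∷ []
pushBit b ((l , c) ∷ rs) = push (eqB b c)
  where
  push : Bool → RunList
  push true  = (suc l , c) ∷ rs
  push false = (1 , b) ∷ (l , c) ∷ rs

runs-∷ : ∀ b xs → runs (b ∷ xs) ≡ pushBit b (runs xs)
runs-∷ b xs with runs xs
... | [] = refl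
... | (l , c) ∷ rs with eqB b c
...   | true  = refl
...   | false = refl

runs-++ : ∀ xs ys → runs (xs ++ ys) ≡ foldr pushBit (runs ys) xs
runs-++ []       ys = refl
runs-++ (x ∷ xs) ys = trans (runs-∷ x (xs ++ ys)) (cong (pushBit x) (runs-++ xs ys))

runs-block : ∀ l b E →
  runs (bin l ++ not b ∷ E) ≡ foldr pushBit (pushBit (not b) (runs E)) (bin l)
runs-block l b E =
  trans (runs-++ (bin l) (not b ∷ E))
        (cong (λ acc → foldr pushBit acc (bin l)) (runs-∷ (not b) E))

maxRun : Bool → ℕ
maxRun true  = 5
maxRun false = 3

data Bounded : Bool → RunList → Set where
  []  : ∀ {b} → Bounded b []
  _∷_ : ∀ {b l rs} → (1 ≤ l) × (l ≤ maxRun b) → Bounded (not b) rs → Bounded b ((l , b) ∷ rs)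

ShortHead : RunList → Set
ShortHead []            = ⊤
ShortHead ((l , _) ∷ _) = l ≤ 2

EncodedShape : Bool → RunList → Set
EncodedShape true  acc = Bounded true acc × ShortHead acc
EncodedShape false acc = Bounded true acc

shape⇒bounded : ∀ b {acc} → EncodedShape b acc → Bounded true acc
shape⇒bounded true  = proj₁
shape⇒bounded false shape = shape

push0-separates : ∀ {acc} → Bounded true acc → pushBit false acc ≡ (1 , false) ∷ acc
push0-separates []      = refl
push0-separates (_ ∷ _) = refl

-- Encoding a run of 1s of length l ≤ 5 in front of a 1-bounded suffix:
-- the block is one of 10, 100, 110, 1000, 1010.
encode-ones : ∀ l → 1 ≤ l → l ≤ 5 → ∀ {acc} → Bounded true acc →
  EncodedShape true (foldr pushBit (pushBit false acc) (bin l))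
encode-ones l 1≤l l≤5 {acc} bnd rewrite push0-separates bnd = block l 1≤l l≤5
  where
  block : ∀ l → 1 ≤ l → l ≤ 5 → EncodedShape true (foldr pushBit ((1 , false) ∷ acc) (bin l))
  block 1 _ _ = ((≤-lit , ≤-lit) ∷ (≤-lit , ≤-lit) ∷ bnd) , ≤-lit
  block 2 _ _ = ((≤-lit , ≤-lit) ∷ (≤-lit , ≤-lit) ∷ bnd) , ≤-lit
  block 3 _ _ = ((≤-lit , ≤-lit) ∷ (≤-lit , ≤-lit) ∷ bnd) , ≤-lit
  block 4 _ _ = ((≤-lit , ≤-lit) ∷ (≤-lit , ≤-lit) ∷ bnd) , ≤-lit
  block 5 _ _ = ((≤-lit , ≤-lit) ∷ (≤-lit , ≤-lit) ∷ (≤-lit , ≤-lit) ∷ (≤-lit , ≤-lit) ∷ bnd) , ≤-lit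
  block (suc (suc (suc (suc (suc (suc _)))))) _ (s≤s (s≤s (s≤s (s≤s (s≤s ())))))

-- Encoding a run of 0s of length l ≤ 3 in front of a suffix with short
-- first run h ≤ 2: the block is one of 11, 101, 111, and its trailing
-- 1s merge with the suffix into a run of at most 3 + h ≤ 5 ones.
encode-zeros : ∀ l → 1 ≤ l → l ≤ 3 → ∀ {acc} → EncodedShape true acc →
  Bounded true (foldr pushBit (pushBit true acc) (bin l))
encode-zeros 1 _ _ ([] , _) = (≤-lit , ≤-lit) ∷ []
encode-zeros 2 _ _ ([] , _) = (≤-lit , ≤-lit) ∷ (≤-lit , ≤-lit) ∷ (≤-lit , ≤-lit) ∷ []
encode-zeros 3 _ _ ([] , _) = (≤-lit , ≤-lit) ∷ []
encode-zeros 1 _ _ ((_ ∷ bnd) , h≤2) = (≤-lit , s≤s (s≤s (≤-trans h≤2 ≤-lit))) ∷ bnd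
encode-zeros 2 _ _ ((_ ∷ bnd) , h≤2) =
  (≤-lit , ≤-lit) ∷ (≤-lit , ≤-lit) ∷ (≤-lit , s≤s (≤-trans h≤2 ≤-lit)) ∷ bnd
encode-zeros 3 _ _ ((_ ∷ bnd) , h≤2) = (≤-lit , s≤s (s≤s (s≤s h≤2))) ∷ bnd
encode-zeros (suc (suc (suc (suc _)))) _ (s≤s (s≤s (s≤s ()))) _

encode-bounded : ∀ b {rs} → Bounded b rs → EncodedShape b (runs (encodeRuns rs))
encode-bounded true  [] = [] , _
encode-bounded false [] = []
encode-bounded true {(l , _) ∷ rs} ((1≤l , l≤5) ∷ bnd) =
  subst (EncodedShape true) (sym (runs-block l true (encodeRuns rs)))
    (encode-ones l 1≤l l≤5 (encode-bounded false bnd))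
encode-bounded false {(l , _) ∷ rs} ((1≤l , l≤3) ∷ bnd) =
  subst (Bounded true) (sym (runs-block l false (encodeRuns rs)))
    (encode-zeros l 1≤l l≤3 (encode-bounded true bnd))

s-bounded : ∀ n → Bounded true (runs (s n))
s-bounded zero    = (≤-lit , ≤-lit) ∷ []
s-bounded (suc n) = shape⇒bounded true (encode-bounded true (s-bounded n))

zero-run-bound : ∀ {b rs ℓ} → Bounded b rs → (ℓ , false) ∈ rs → ℓ ≤ 3
zero-run-bound ((_ , ℓ≤3) ∷ _) (here refl) = ℓ≤3
zero-run-bound (_ ∷ bnd)        (there ℓ∈rs) = zero-run-bound bnd ℓ∈rs

corollary1 : (n : ℕ) → 1 ≤ n → (ℓ : ℕ) → (ℓ , false) ∈ runs (sₙ n) → ℓ ≤ 3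
corollary1 (suc n) _ ℓ ℓ∈runs = zero-run-bound (s-bounded n) ℓ∈runs
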